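{- Let $n\ge4$ and let $\mathcal{R}$ be a strict polarized rectifier network with $m$ edges realizing $K_n$, and let $x$ be a base vertex of $\mathcal{R}$. If the total degree of $x$ is exactly $1$, then there is a strict polarized rectifier network realizing $K_n$ with at most $m-1$ edges.
   Context: $K_n$ denotes the diagram on $n$ vertices in which every pair of distinct vertices is joined by an undirected edge. A diagram is a loopless graph with undirected and directed edges such that for all $u,v$ at most one of $\{u,v\},(u,v),(v,u)$ is an edge. A polarized diagram of a diagram is a pair $(G',p)$ where $G'$ is obtained by orienting each undirected edge arbitrarily and $p:E(G')\to\{ -,+\}$ assigns $-$ to formerly undirected edges and $+$ to originally directed edges. A polarized rectifier network (PRN) is $\mathcal{R}=(B,A,E,p)$ with $B,A$ disjoint vertex sets (base and auxiliary), $(B\sqcup A,E)$ a loopless directed graph (the total degree of a vertex is its number of incident edges, incoming plus outgoing), and $p:\{(u,v)\in E:v\in B\}\to\{ -,+\}$. For $u,v\in B$ (possibly equal), a valid walk from $u$ to $v$ is a sequence $(\pi_1,\dots,\pi_k)$, $k\ge2$, with $\pi_1=u$, $\pi_k=v$, each $(\pi_i,\pi_{i+1})\in E$, and $\pi_i\in A$ for $2\le i\le k-1$; its polarity is $p(\pi_{k-1},\pi_k)$. A PRN $(V(G'),A,E,p')$ realizes $(G',p)$ if for all $u,v\in V(G')$ (possibly equal), $(u,v)\in E(G')$ iff there is a valid walk from $u$ to $v$ with polarity $p(u,v)$ (and there is no valid walk when $(u,v)\notin E(G')$); it realizes a diagram $G$ if it realizes some polarized diagram of $G$. A PRN is strict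 if (1) for every 2-element $\{u,v\}\subseteq B$ there is at most one valid walk from $u$ to $v$ or from $v$ to $u$ in total, and (2) every vertex of $A$ lies on some valid walk. -}

module Defs where

open import Data.Nat using (ℕ; _≤_; _∸_)
open import Data.Fin using (Fin)
open import Data.Fin.Properties using () renaming (_≟_ to _≟ᶠ_)
open import Data.Sum using (_⊎_; inj₁; inj₂)
open import Data.Sum.Properties using (≡-dec)
open import Data.Product using (_×_; _,_; Σ; ∃; ∃-syntax; proj₁; proj₂)
open import Data.Product.Properties using () renaming (≡-dec to ×-≡-dec)
open import Data.Bool using (Bool; true; false; not)
open import Data.List using (List; []; _∷_; length; filter)
open import Data.List.Membership.Propositional using (_∈_; _∉_)
open import Data.List.Relation.Unary.Unique.Propositional using (Unique)
open import Relation.Binary.PropositionalEquality using (_≡_; _≢_)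
open import Relation.Nullary using (¬_; Dec)
open import Relation.Nullary.Decidable using (_⊎-dec_)
open import Data.Empty using (⊥)

data Pol : Set where
  minus plus : Pol

-- vertices of a PRN with base set Fin n and auxiliary set Fin a
Vertex : ℕ → ℕ → Set
Vertex n a = Fin n ⊎ Fin a

_≟ᵛ_ : ∀ {n a} (x y : Vertex n a) → Dec (x ≡ y)
_≟ᵛ_ = ≡-dec _≟ᶠ_ _≟ᶠ_

-- The edge set is a duplicate-free list of ordered pairs (so m = length of
-- the list); the polarity is given on all pairs (x , v) with v base, but only
-- its values on edges matter.
record PRN (n : ℕ) : Set where
  field
    aux      : ℕ
    edges    : List (Vertex n aux × Vertex n aux)
    unique   : Unique edges
    loopless : ∀ x → (x , x) ∉ edges
    pol      : Vertex n aux → Fin n → Pol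

module _ {n : ℕ} (R : PRN n) where
  open PRN R

  size : ℕ
  size = length edges

  degree : Vertex n aux → ℕ
  degree x = length (filter (λ e → (proj₁ e ≟ᵛ x) ⊎-dec (proj₂ e ≟ᵛ x)) edges)

  Steps : Vertex n aux → List (Fin aux) → Vertex n aux → Set
  Steps x []       y = (x , y) ∈ edges
  Steps x (w ∷ ws) y = ((x , inj₂ w) ∈ edges) × Steps (inj₂ w) ws y

  penult : Vertex n aux → List (Fin aux) → Vertex n aux
  penult x []       = x
  penult x (w ∷ ws) = penult (inj₂ w) ws

  ValidWalk : Fin n → List (Fin aux) → Fin n → Set
  ValidWalk u ws v = Steps (inj₁ u) ws (inj₁ v)

  walkPol : Fin n → List (Fin aux) → Fin n → Pol
  walkPol u ws v = pol (penult (inj₁ u) ws) v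

  Strict : Set
  Strict =
    (∀ u v → u ≢ v → ∀ ws ws' → ValidWalk u ws v → ValidWalk u ws' v → ws ≡ ws')
    × (∀ u v → u ≢ v → ∀ ws ws' → ValidWalk u ws v → ValidWalk v ws' u → ⊥)
    × (∀ (a : Fin aux) → ∃[ u ] ∃[ ws ] ∃[ v ] (ValidWalk u ws v × a ∈ ws))

  -- realizing a polarized diagram of K_n: such a diagram is an orientation
  -- T of K_n (T u v ≡ true iff u→v is an edge) with all polarities minus.
  RealizesOrientation : (Fin n → Fin n → Bool) → Set
  RealizesOrientation T =
    (∀ u v → T u v ≡ true → ∃[ ws ] (ValidWalk u ws v × walkPol u ws v ≡ minus))
    × (∀ u v → ∃[ ws ] (ValidWalk u ws v × walkPol u ws v ≡ minus) → T u v ≡ true)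
    × (∀ u v → T u v ≡ false → ∀ ws → ¬ ValidWalk u ws v)

IsOrientationOfK : (n : ℕ) → (Fin n → Fin n → Bool) → Set
IsOrientationOfK n T =
  (∀ u → T u u ≡ false) × (∀ u v → u ≢ v → T v u ≡ not (T u v))

RealizesK : (n : ℕ) → PRN n → Set
RealizesK n R = ∃[ T ] (IsOrientationOfK n T × RealizesOrientation R T)

-- The sole edge at x may be assumed to leave x; otherwise transpose the network, which
-- preserves strictness, size and realizing K_n.  As no edge enters x, K_n forces a valid
-- walk from x to every other base vertex, and each such walk begins with the sole edge.
-- So that edge cannot end at a base vertex (n ≥ 3 leaves a base vertex it misses); it
-- ends at an auxiliary a, which then reaches every base vertex v ≠ x.  Moreover x is the
-- only in-neighbour of a: an edge u → a from a base u ≠ x closes a valid walk u → a ⇝ u,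
-- which K_n forbids, and an auxiliary in-neighbour lies on a valid walk whose prefix,
-- continued by → a ⇝ y, gives such a closed walk or a second valid walk from x to y
-- besides x → a ⇝ y.  Hence deleting x → a and identifying a with x maps the valid walks
-- bijectively onto those of a network with one edge fewer, keeping their ends.
module Submission where

open import Defs
open import Data.Nat using (ℕ; suc; _≤_; _∸_; s≤s)
open import Data.Nat.Properties using (<⇒≤pred; module ≤-Reasoning)
open import Data.Fin using (Fin; zero; punchIn; punchOut)
open import Data.Fin.Properties
  using (punchInᵢ≢i; punchIn-injective; punchIn-punchOut; punchOut-punchIn; punchOut-cong)
  renaming (_≟_ to _≟ᶠ_)
open import Data.Sum using (_⊎_; inj₁; inj₂; map₂)
import Data.Sum as Sum
open import Data.Sum.Properties using (inj₁-injective)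
open import Data.Product using (_×_; _,_; ∃-syntax; proj₁; proj₂; swap)
import Data.Product as Product
open import Data.Bool using (true; false; not)
open import Data.Maybe using (Maybe; just; nothing; maybe′)
import Data.Maybe.Relation.Unary.Any as MAny
open import Data.List using (List; []; _∷_; _++_; [_]; filter; map; mapMaybe; reverse)
open import Data.List.Properties
  using (length-map; unfold-reverse; reverse-injective; filter-notAll;
         ++-identityˡ-unique; ++-conicalʳ; mapMaybe-map-retract)
open import Data.List.Membership.Propositional using (_∈_; _∉_)
open import Data.List.Membership.Propositional.Properties
  using (∈-map⁺; ∈-map⁻; ∈-filter⁺; ∈-filter⁻)
open import Data.List.Relation.Unary.Any using (here; there)
import Data.List.Relation.Unary.Any as Any
open import Data.List.Relation.Unary.Any.Properties using (reverse⁺; mapMaybe⁺)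
import Data.List.Relation.Unary.Any.Properties as Any
import Data.List.Relation.Unary.All as All
import Data.List.Relation.Unary.All.Properties as All
open import Data.List.Relation.Unary.AllPairs using ([]; _∷_)
open import Data.List.Relation.Unary.Unique.Propositional using (Unique)
import Data.List.Relation.Unary.Unique.Propositional.Properties as Unique
open import Function using (_∘_; id; case_of_)
open import Relation.Binary.PropositionalEquality
  using (_≡_; _≢_; refl; sym; trans; cong; cong₂; subst; module ≡-Reasoning)
open import Relation.Nullary using (¬_; Dec; yes; no)
open import Relation.Nullary.Decidable using (_⊎-dec_; ¬?)
open import Data.Empty using (⊥-elim)

Unique-map⁺-on : ∀ {A B : Set} {f : A → B} {xs : List A} →
                 (∀ {x y} → x ∈ xs → y ∈ xs → f x ≡ f y → x ≡ y) →
                 Unique xs → Unique (map f xs)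
Unique-map⁺-on inj [] = []
Unique-map⁺-on inj (x∉xs ∷ xs!) =
  All.map⁺ (All.tabulate λ y∈xs fx≡fy →
             All.lookup x∉xs y∈xs (inj (here refl) (there y∈xs) fx≡fy))
  ∷ Unique-map⁺-on (λ x∈xs y∈xs → inj (there x∈xs) (there y∈xs)) xs!

∃-≢₂ : ∀ {m} (x z : Fin (suc (suc (suc m)))) → x ≢ z → ∃[ v ] (v ≢ x × v ≢ z)
∃-≢₂ x z x≢z =
  punchIn x (punchIn j zero) , punchInᵢ≢i x _ ,
  λ v≡z → punchInᵢ≢i j zero (punchIn-injective x _ _ (trans v≡z (sym (punchIn-punchOut x≢z))))
  where j = punchOut x≢z

orientation-total : ∀ {n T} → IsOrientationOfK n T →
                    ∀ {u v} → u ≢ v → T u v ≡ true ⊎ T v u ≡ true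
orientation-total {T = T} (_ , antisym) {u} {v} u≢v with T u v in eq
... | true  = inj₁ refl
... | false = inj₂ (trans (antisym u v u≢v) (cong not eq))

module _ {n} (R : PRN n) where
  open PRN R

  Steps-++ : ∀ {s c t} xs ys → Steps R s xs (inj₂ c) → Steps R (inj₂ c) ys t →
             Steps R s (xs ++ c ∷ ys) t
  Steps-++ []       ys e         st  = e , st
  Steps-++ (_ ∷ xs) ys (e , st₁) st₂ = e , Steps-++ xs ys st₁ st₂

  Steps-prefix : ∀ {s t w} ws → Steps R s ws t → w ∈ ws → ∃[ pre ] Steps R s pre (inj₂ w)
  Steps-prefix (_ ∷ _)  (e , _)  (here refl) = [] , e
  Steps-prefix (b ∷ ws) (e , st) (there w∈ws) =
    let (pre , st′) = Steps-prefix ws st w∈ws in b ∷ pre , e , st′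

  Steps-lastEdge : ∀ {s t} ws → Steps R s ws t → ∃[ p ] (p , t) ∈ edges
  Steps-lastEdge {s} []       e        = s , e
  Steps-lastEdge     (_ ∷ ws) (_ , st) = Steps-lastEdge ws st

  module _ {T} (Rz : RealizesOrientation R T) where

    ValidWalk⇒T : ∀ {u ws v} → ValidWalk R u ws v → T u v ≡ true
    ValidWalk⇒T {u} {ws} {v} w with T u v in eq
    ... | true  = refl
    ... | false = ⊥-elim (proj₂ (proj₂ Rz) u v eq ws w)

    T⇒ValidWalk : ∀ {u v} → T u v ≡ true → ∃[ ws ] ValidWalk R u ws v
    T⇒ValidWalk {u} {v} Tuv = let (ws , w , _) = proj₁ Rz u v Tuv in ws , w

    no-closed-walk : IsOrientationOfK n T → ∀ {u ws} → ¬ ValidWalk R u ws u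
    no-closed-walk (irrefl , _) {u} {ws} = proj₂ (proj₂ Rz) u u (irrefl u) ws

Incident : ∀ {n a} → Vertex n a → Vertex n a × Vertex n a → Set
Incident v e = proj₁ e ≡ v ⊎ proj₂ e ≡ v

Incident? : ∀ {n a} (v : Vertex n a) (e : Vertex n a × Vertex n a) → Dec (Incident v e)
Incident? v e = (proj₁ e ≟ᵛ v) ⊎-dec (proj₂ e ≟ᵛ v)

SoleEdge : ∀ {n} (R : PRN n) → let open PRN R in Vertex n aux → Vertex n aux × Vertex n aux → Set
SoleEdge R v e = e ∈ edges × (∀ {e′} → e′ ∈ edges → Incident v e′ → e′ ≡ e)
  where open PRN R

degree≡1⇒SoleEdge : ∀ {n} (R : PRN n) {v} → degree R v ≡ 1 →
                    ∃[ e ] (Incident v e × SoleEdge R v e)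
degree≡1⇒SoleEdge R {v} deg with filter (Incident? v) (PRN.edges R) in eq | deg
... | e ∷ [] | refl = e , proj₂ e∈edges×incident , proj₁ e∈edges×incident , sole
  where
  e∈edges×incident : e ∈ PRN.edges R × Incident v e
  e∈edges×incident = ∈-filter⁻ (Incident? v) (subst (e ∈_) (sym eq) (here refl))
  sole : ∀ {e′} → e′ ∈ PRN.edges R → Incident v e′ → e′ ≡ e
  sole e′∈edges incident with subst (_ ∈_) eq (∈-filter⁺ (Incident? v) e′∈edges incident)
  ... | here e′≡e = e′≡e

Shrinks : ∀ {n} → PRN n → Set
Shrinks {n} R = ∃[ R′ ] (Strict R′ × RealizesK n R′ × size R′ ≤ size R ∸ 1)

-- Realizing K_n only involves the polarity −, so the polarities are reset to −.
transpose : ∀ {n} → PRN n → PRN n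
transpose R = record
  { aux      = aux
  ; edges    = map swap edges
  ; unique   = Unique.map⁺ (cong swap) unique
  ; loopless = loopless′
  ; pol      = λ _ _ → minus
  }
  where
  open PRN R
  loopless′ : ∀ v → (v , v) ∉ map swap edges
  loopless′ v vv∈ with ∈-map⁻ swap vv∈
  ... | _ , vv∈edges , refl = loopless v vv∈edges

module _ {n} (R : PRN n) where
  open PRN R

  Steps-transpose : ∀ {s t} ws → Steps R s ws t → Steps (transpose R) t (reverse ws) s
  Steps-transpose []       e = ∈-map⁺ swap e
  Steps-transpose {s} {t} (b ∷ ws) (e , st) =
    subst (λ ws′ → Steps (transpose R) t ws′ s) (sym (unfold-reverse b ws))
      (Steps-++ (transpose R) (reverse ws) [] (Steps-transpose ws st) (∈-map⁺ swap e))

  edge-transpose⁻ : ∀ {p q} → (q , p) ∈ PRN.edges (transpose R) → (p , q) ∈ edges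
  edge-transpose⁻ qp∈ with ∈-map⁻ swap qp∈
  ... | _ , pq∈edges , refl = pq∈edges

  Steps-transpose⁻ : ∀ {s t} ws → Steps (transpose R) s ws t → Steps R t (reverse ws) s
  Steps-transpose⁻ []       e = edge-transpose⁻ e
  Steps-transpose⁻ {s} {t} (b ∷ ws) (e , st) =
    subst (λ ws′ → Steps R t ws′ s) (sym (unfold-reverse b ws))
      (Steps-++ R (reverse ws) [] (Steps-transpose⁻ ws st) (edge-transpose⁻ e))

  Strict-transpose : Strict R → Strict (transpose R)
  Strict-transpose (unique-walk , no-opposite-walks , aux-on-walk) =
      (λ u v u≢v ws ws′ w w′ → reverse-injective
         (unique-walk v u (u≢v ∘ sym) _ _ (Steps-transpose⁻ ws w) (Steps-transpose⁻ ws′ w′)))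
    , (λ u v u≢v ws ws′ w w′ →
         no-opposite-walks v u (u≢v ∘ sym) _ _ (Steps-transpose⁻ ws w) (Steps-transpose⁻ ws′ w′))
    , λ b → let (u , ws , v , w , b∈ws) = aux-on-walk b in
            v , reverse ws , u , Steps-transpose ws w , reverse⁺ b∈ws

  RealizesK-transpose : RealizesK n R → RealizesK n (transpose R)
  RealizesK-transpose (T , (irrefl , antisym) , Rz@(_ , _ , no-walks)) =
      (λ u v → T v u)
    , (irrefl , λ u v u≢v → antisym v u (u≢v ∘ sym))
    , (λ u v Tvu → let (ws , w) = T⇒ValidWalk R Rz Tvu in reverse ws , Steps-transpose ws w , refl)
    , (λ u v (ws , w , _) → ValidWalk⇒T R Rz (Steps-transpose⁻ ws w))
    , λ u v Tvu≡false ws w → no-walks v u Tvu≡false (reverse ws) (Steps-transpose⁻ ws w)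

  size-transpose : size (transpose R) ≡ size R
  size-transpose = length-map swap edges

  SoleEdge-transpose : ∀ {v p q} → SoleEdge R v (p , q) → SoleEdge (transpose R) v (q , p)
  SoleEdge-transpose (pq∈edges , sole) = ∈-map⁺ swap pq∈edges , sole′
    where
    sole′ : ∀ {e} → e ∈ map swap edges → Incident _ e → e ≡ _
    sole′ e∈ incident with ∈-map⁻ swap e∈
    ... | _ , e′∈edges , refl = cong swap (sole e′∈edges (Sum.swap incident))

Shrinks-transpose : ∀ {n} (R : PRN n) → Shrinks (transpose R) → Shrinks R
Shrinks-transpose R (R′ , S′ , Rz′ , size≤) =
  transpose R′ , Strict-transpose R′ S′ , RealizesK-transpose R′ Rz′ ,
  (begin
    size (transpose R′)      ≡⟨ size-transpose R′ ⟩
    size R′                  ≤⟨ size≤ ⟩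
    size (transpose R) ∸ 1   ≡⟨ cong (_∸ 1) (size-transpose R) ⟩
    size R ∸ 1               ∎)
  where open ≤-Reasoning

module SoleOutEdge {n} (R : PRN n) {x : Fin n} {q} (sole : SoleEdge R (inj₁ x) (inj₁ x , q)) where
  open PRN R

  edge-from-x : ∀ {q′} → (inj₁ x , q′) ∈ edges → q′ ≡ q
  edge-from-x e = cong proj₂ (proj₂ sole e (inj₁ refl))

  no-edge-into-x : ∀ {p} → (p , inj₁ x) ∉ edges
  no-edge-into-x {p} e =
    loopless (inj₁ x)
      (subst (λ p → (p , inj₁ x) ∈ edges) (cong proj₁ (proj₂ sole e (inj₂ refl))) e)

  module _ {T} (To : IsOrientationOfK n T) (Rz : RealizesOrientation R T) where

    walk-from-x : ∀ {v} → x ≢ v → ∃[ ws ] ValidWalk R x ws v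
    walk-from-x x≢v with orientation-total To x≢v
    ... | inj₁ Txv = T⇒ValidWalk R Rz Txv
    ... | inj₂ Tvx =
      let (ws , w) = T⇒ValidWalk R Rz Tvx in ⊥-elim (no-edge-into-x (proj₂ (Steps-lastEdge R ws w)))

sole-out-edge-not-to-base : ∀ {m} (R : PRN (suc (suc (suc m)))) {x z} →
                            RealizesK _ R → ¬ SoleEdge R (inj₁ x) (inj₁ x , inj₁ z)
sole-out-edge-not-to-base R {x} {z} (T , To , Rz) sole =
  let (v , v≢x , v≢z) = ∃-≢₂ x z x≢z in no-walk-from-x v≢z (walk-from-x To Rz (v≢x ∘ sym))
  where
  open SoleOutEdge R sole
  x≢z : x ≢ z
  x≢z refl = PRN.loopless R _ (proj₁ sole)
  no-walk-from-x : ∀ {v} → v ≢ z → ¬ (∃[ ws ] ValidWalk R x ws v)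
  no-walk-from-x v≢z ([] , e) = v≢z (inj₁-injective (edge-from-x e))
  no-walk-from-x v≢z (_ ∷ _ , e , _) with edge-from-x e
  ... | ()

module SoleOutEdgeToAux {n} (R : PRN n) {x a} (sole : SoleEdge R (inj₁ x) (inj₁ x , inj₂ a))
                     {T} (To : IsOrientationOfK n T) (Rz : RealizesOrientation R T) (S : Strict R) where
  open PRN R
  open SoleOutEdge R sole

  walk-from-a : ∀ {v} → x ≢ v → ∃[ r ] Steps R (inj₂ a) r (inj₁ v)
  walk-from-a x≢v with walk-from-x To Rz x≢v
  ... | [] , e with edge-from-x e
  ...   | ()
  walk-from-a x≢v | _ ∷ r , e , st with edge-from-x e
  ...   | refl = r , st

  Steps-to-a⇒x→a : ∀ {y} → x ≢ y →
                   ∀ {u} pre → Steps R (inj₁ u) pre (inj₂ a) → u ≡ x × pre ≡ []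
  Steps-to-a⇒x→a x≢y {u} pre st with u ≟ᶠ x
  ... | no u≢x =
    let (r , st′) = walk-from-a (u≢x ∘ sym) in
    ⊥-elim (no-closed-walk R Rz To (Steps-++ R pre r st st′))
  ... | yes refl =
    let (r , st′) = walk-from-a x≢y in
    refl , ++-identityˡ-unique pre
             (proj₁ S x _ x≢y (a ∷ r) (pre ++ a ∷ r) (proj₁ sole , st′) (Steps-++ R pre r st st′))

  edge-to-a⇒from-x : ∀ {y} → x ≢ y → ∀ {p} → (p , inj₂ a) ∈ edges → p ≡ inj₁ x
  edge-to-a⇒from-x x≢y {inj₁ u} e = cong inj₁ (proj₁ (Steps-to-a⇒x→a x≢y [] e))
  edge-to-a⇒from-x x≢y {inj₂ w} e =
    let (_ , ws , _ , walk , w∈ws) = proj₂ (proj₂ S) w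
        (pre , st) = Steps-prefix R ws walk w∈ws
        pre++w≡[] = proj₂ (Steps-to-a⇒x→a x≢y (pre ++ [ w ]) (Steps-++ R pre [] st e))
    in case ++-conicalʳ pre [ w ] pre++w≡[] of λ ()

module Contraction {n k} (E : List (Vertex n (suc k) × Vertex n (suc k))) (E! : Unique E)
                   (E-loopless : ∀ v → (v , v) ∉ E) (pol : Vertex n (suc k) → Fin n → Pol) where

  R : PRN n
  R = record { aux = suc k ; edges = E ; unique = E! ; loopless = E-loopless ; pol = pol }

  module _ {x a} (sole : SoleEdge R (inj₁ x) (inj₁ x , inj₂ a))
           (edge-to-a⇒from-x : ∀ {p} → (p , inj₂ a) ∈ E → p ≡ inj₁ x) where
    open SoleOutEdge R sole

    collapseAux : Fin (suc k) → Maybe (Fin k)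
    collapseAux b with a ≟ᶠ b
    ... | yes _   = nothing
    ... | no a≢b = just (punchOut a≢b)

    collapseAux-a : collapseAux a ≡ nothing
    collapseAux-a with a ≟ᶠ a
    ... | yes _   = refl
    ... | no a≢a = ⊥-elim (a≢a refl)

    collapseAux-punchIn : ∀ b → collapseAux (punchIn a b) ≡ just b
    collapseAux-punchIn b with a ≟ᶠ punchIn a b
    ... | yes a≡ = ⊥-elim (punchInᵢ≢i a b (sym a≡))
    ... | no _   = cong just (trans (punchOut-cong a refl) (punchOut-punchIn a))

    collapse : Vertex n (suc k) → Vertex n k
    collapse (inj₁ v) = inj₁ v
    collapse (inj₂ b) = maybe′ inj₂ (inj₁ x) (collapseAux b)

    collapse* : List (Fin (suc k)) → List (Fin k)
    collapse* = mapMaybe collapseAux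

    -- Kept edges never enter x or a, so their sources are restored by expand (x ↦ a)
    -- and their targets by embed (x ↦ x).
    expand : Vertex n k → Vertex n (suc k)
    expand (inj₁ v) with v ≟ᶠ x
    ... | yes _ = inj₂ a
    ... | no _  = inj₁ v
    expand (inj₂ b) = inj₂ (punchIn a b)

    embed : Vertex n k → Vertex n (suc k)
    embed = map₂ (punchIn a)

    expand-x : expand (inj₁ x) ≡ inj₂ a
    expand-x with x ≟ᶠ x
    ... | yes _   = refl
    ... | no x≢x = ⊥-elim (x≢x refl)

    expand-collapse : ∀ {p} → p ≢ inj₁ x → expand (collapse p) ≡ p
    expand-collapse {inj₁ v} p≢x with v ≟ᶠ x
    ... | yes refl = ⊥-elim (p≢x refl)
    ... | no _     = refl
    expand-collapse {inj₂ b} _ with a ≟ᶠ b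
    ... | yes refl = expand-x
    ... | no a≢b   = cong inj₂ (punchIn-punchOut a≢b)

    embed-collapse : ∀ {q} → q ≢ inj₂ a → embed (collapse q) ≡ q
    embed-collapse {inj₁ v} _ = refl
    embed-collapse {inj₂ b} q≢a with a ≟ᶠ b
    ... | yes refl = ⊥-elim (q≢a refl)
    ... | no a≢b   = cong inj₂ (punchIn-punchOut a≢b)

    kept? : (e : Vertex n (suc k) × Vertex n (suc k)) → Dec (proj₁ e ≢ inj₁ x)
    kept? e = ¬? (proj₁ e ≟ᵛ inj₁ x)

    kept : List (Vertex n (suc k) × Vertex n (suc k))
    kept = filter kept? E

    collapse² : Vertex n (suc k) × Vertex n (suc k) → Vertex n k × Vertex n k
    collapse² = Product.map collapse collapse

    uncollapse² : Vertex n k × Vertex n k → Vertex n (suc k) × Vertex n (suc k)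
    uncollapse² = Product.map expand embed

    uncollapse-collapse : ∀ {e} → e ∈ kept → uncollapse² (collapse² e) ≡ e
    uncollapse-collapse {p , q} e∈kept = cong₂ _,_ (expand-collapse p≢x) (embed-collapse q≢a)
      where
      p≢x : p ≢ inj₁ x
      p≢x = proj₂ (∈-filter⁻ kept? {xs = E} e∈kept)
      q≢a : q ≢ inj₂ a
      q≢a refl = p≢x (edge-to-a⇒from-x (proj₁ (∈-filter⁻ kept? {xs = E} e∈kept)))

    collapse²-injective : ∀ {e e′} → e ∈ kept → e′ ∈ kept →
                          collapse² e ≡ collapse² e′ → e ≡ e′
    collapse²-injective {e} {e′} e∈kept e′∈kept eq = begin
      e                          ≡⟨ sym (uncollapse-collapse e∈kept) ⟩
      uncollapse² (collapse² e)  ≡⟨ cong uncollapse² eq ⟩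
      uncollapse² (collapse² e′) ≡⟨ uncollapse-collapse e′∈kept ⟩
      e′                         ∎
      where open ≡-Reasoning

    contracted-edges : List (Vertex n k × Vertex n k)
    contracted-edges = map collapse² kept

    edge-collapse : ∀ {p q} → (p , q) ∈ E → p ≢ inj₁ x →
                    (collapse p , collapse q) ∈ contracted-edges
    edge-collapse e p≢x = ∈-map⁺ collapse² (∈-filter⁺ kept? e p≢x)

    edge-expand : ∀ {p′ q′} → (p′ , q′) ∈ contracted-edges → (expand p′ , embed q′) ∈ E
    edge-expand e′ with ∈-map⁻ collapse² e′
    ... | e , e∈kept , refl =
      subst (_∈ E) (sym (uncollapse-collapse e∈kept)) (proj₁ (∈-filter⁻ kept? {xs = E} e∈kept))

    contracted-loopless : ∀ v → (v , v) ∉ contracted-edges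
    contracted-loopless (inj₂ _) vv∈ = E-loopless _ (edge-expand vv∈)
    contracted-loopless (inj₁ w) vv∈ with w ≟ᶠ x | edge-expand vv∈
    ... | yes refl | e = no-edge-into-x e
    ... | no _     | e = E-loopless _ e

    contraction : PRN n
    contraction = record
      { aux      = k
      ; edges    = contracted-edges
      ; unique   = Unique-map⁺-on collapse²-injective (Unique.filter⁺ kept? E!)
      ; loopless = contracted-loopless
      ; pol      = λ _ _ → minus
      }

    size-contraction : size contraction ≤ size R ∸ 1
    size-contraction =
      subst (_≤ size R ∸ 1) (sym (length-map collapse² kept))
            (<⇒≤pred (filter-notAll kept? E (Any.map (λ { refl p≢x → p≢x refl }) (proj₁ sole))))

    Steps-collapse : ∀ {s t} ws → s ≢ inj₁ x → Steps R s ws t →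
                     Steps contraction (collapse s) (collapse* ws) (collapse t)
    Steps-collapse []       s≢x e        = edge-collapse e s≢x
    Steps-collapse (b ∷ ws) s≢x (e , st)
      with a ≟ᶠ b | edge-collapse e s≢x | Steps-collapse ws (λ ()) st
    ... | yes refl | _  | _   = ⊥-elim (s≢x (edge-to-a⇒from-x e))
    ... | no _     | e′ | st′ = e′ , st′

    ValidWalk-collapse : ∀ {u ws v} → ValidWalk R u ws v → ValidWalk contraction u (collapse* ws) v
    ValidWalk-collapse {u} {ws} w with u ≟ᶠ x
    ... | no u≢x   = Steps-collapse ws (u≢x ∘ inj₁-injective) w
    ... | yes refl = from-x ws w
      where
      from-x : ∀ {v} ws → ValidWalk R x ws v → ValidWalk contraction x (collapse* ws) v
      from-x [] e with edge-from-x e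
      ... | ()
      from-x (_ ∷ r) (e , st) with edge-from-x e
      ... | refl with a ≟ᶠ a | Steps-collapse r (λ ()) st
      ...   | yes _   | st′ = st′
      ...   | no a≢a | _   = ⊥-elim (a≢a refl)

    collapse*-a : ∀ ws → collapse* (a ∷ ws) ≡ collapse* ws
    collapse*-a ws = cong (λ c → maybe′ _∷_ id c (collapse* ws)) collapseAux-a

    Steps-expand : ∀ {s′ t′} ws′ → Steps contraction s′ ws′ t′ →
                   Steps R (expand s′) (map (punchIn a) ws′) (embed t′)
    Steps-expand []        e        = edge-expand e
    Steps-expand (_ ∷ ws′) (e , st) = edge-expand e , Steps-expand ws′ st

    collapse*-map-punchIn : ∀ ws′ → collapse* (map (punchIn a) ws′) ≡ ws′
    collapse*-map-punchIn = mapMaybe-map-retract collapseAux-punchIn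

    ValidWalk-expand : ∀ {u ws′ v} → ValidWalk contraction u ws′ v →
                       ∃[ ws ] (ValidWalk R u ws v × collapse* ws ≡ ws′)
    ValidWalk-expand {u} {ws′} w with u ≟ᶠ x | Steps-expand ws′ w
    ... | no _     | st = map (punchIn a) ws′ , st , collapse*-map-punchIn ws′
    ... | yes refl | st =
      a ∷ map (punchIn a) ws′ , (proj₁ sole , st) ,
      trans (collapse*-a (map (punchIn a) ws′)) (collapse*-map-punchIn ws′)

    ∈-collapse* : ∀ {b ws} → punchIn a b ∈ ws → b ∈ collapse* ws
    ∈-collapse* {b} {ws} b∈ws =
      mapMaybe⁺ collapseAux ws (Any.map⁺ (Any.map (λ { refl → just-b }) b∈ws))
      where
      just-b : MAny.Any (b ≡_) (collapseAux (punchIn a b))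
      just-b = subst (MAny.Any (b ≡_)) (sym (collapseAux-punchIn b)) (MAny.just refl)

    Strict-contraction : Strict R → Strict contraction
    Strict-contraction (unique-walk , no-opposite-walks , aux-on-walk) =
        (λ u v u≢v ws₁′ ws₂′ w₁′ w₂′ →
           let (ws₁ , w₁ , ws₁≡) = ValidWalk-expand w₁′
               (ws₂ , w₂ , ws₂≡) = ValidWalk-expand w₂′
           in trans (sym ws₁≡)
                    (trans (cong collapse* (unique-walk u v u≢v ws₁ ws₂ w₁ w₂)) ws₂≡))
      , (λ u v u≢v _ _ w₁′ w₂′ →
           no-opposite-walks u v u≢v _ _ (proj₁ (proj₂ (ValidWalk-expand w₁′)))
                                         (proj₁ (proj₂ (ValidWalk-expand w₂′))))
      , λ b → let (u , ws , v , w , b∈ws) = aux-on-walk (punchIn a b) in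
              u , collapse* ws , v , ValidWalk-collapse w , ∈-collapse* b∈ws

    RealizesOrientation-contraction : ∀ {T} → RealizesOrientation R T →
                                      RealizesOrientation contraction T
    RealizesOrientation-contraction Rz@(_ , _ , no-walks) =
        (λ u v Tuv → let (ws , w) = T⇒ValidWalk R Rz Tuv in collapse* ws , ValidWalk-collapse w , refl)
      , (λ u v (_ , w′ , _) → ValidWalk⇒T R Rz (proj₁ (proj₂ (ValidWalk-expand w′))))
      , λ u v Tuv≡false _ w′ → no-walks u v Tuv≡false _ (proj₁ (proj₂ (ValidWalk-expand w′)))

    contraction-shrinks : Strict R → RealizesK n R → Shrinks R
    contraction-shrinks S (T , To , Rz) =
      contraction , Strict-contraction S , (T , To , RealizesOrientation-contraction Rz) , size-contraction

shrink-sole-out-edge : ∀ {m} (R : PRN (suc (suc (suc m)))) {x q} → Strict R → RealizesK _ R →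
                       SoleEdge R (inj₁ x) (inj₁ x , q) → Shrinks R
shrink-sole-out-edge R {q = inj₁ _} _ Rz sole = ⊥-elim (sole-out-edge-not-to-base R Rz sole)
shrink-sole-out-edge
  R@(record { aux = suc k ; edges = E ; unique = E! ; loopless = E-loopless ; pol = pol })
  {x} {inj₂ a} S Rz@(_ , To , Rzₒ) sole =
  Contraction.contraction-shrinks E E! E-loopless pol sole
    (SoleOutEdgeToAux.edge-to-a⇒from-x R sole To Rzₒ S (punchInᵢ≢i x zero ∘ sym)) S Rz

lemma31 : (n : ℕ) → 4 ≤ n → (R : PRN n) → Strict R → RealizesK n R →
          (x : Fin n) → degree R (inj₁ x) ≡ 1 →
          ∃[ R' ] (Strict R' × RealizesK n R' × size R' ≤ size R ∸ 1)
lemma31 _ (s≤s (s≤s (s≤s (s≤s _)))) R S Rz x deg with degree≡1⇒SoleEdge R deg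
... | (_ , _) , inj₁ refl , sole = shrink-sole-out-edge R S Rz sole
... | (_ , _) , inj₂ refl , sole =
  Shrinks-transpose R
    (shrink-sole-out-edge (transpose R) (Strict-transpose R S) (RealizesK-transpose R Rz)
                          (SoleEdge-transpose R sole))
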